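{- For the prism (circular ladder graph) $D_n$ on $2n$ vertices, $n\ge3$, with its standard plane embedding (two $n$-gonal faces and $n$ quadrangular faces), $\pi_{fl}(D_n)\le 8$.
   Context: $D_n$ is the Cartesian product $C_n\square P_2$, i.e. two $n$-cycles $v_1\dots v_n$ and $u_1\dots u_n$ with edges $u_iv_i$. A sequence $r_1\dots r_{2n}$ is a repetition if $r_i=r_{n+i}$ for all $i\le n$. In a plane graph $G$, a facial path is a path whose vertices and edges are consecutive on the boundary walk of some face of $G$. A vertex colouring is facial non-repetitive if no facial path on vertices $v_1,\dots,v_{2n}$ ($n\ge1$) has colour sequence that is a repetition. $\pi_{fl}(G)$ is the minimum $l$ such that for every assignment of lists $L(v)\subseteq\mathbb{Z}_+$ with $|L(v)|\ge l$ there is a facial non-repetitive colouring $\varphi$ with $\varphi(v)\in L(v)$ for every vertex $v$. -}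

module Defs where

open import Data.Nat using (ℕ; zero; suc; _+_; _*_; _∸_; _≤_; _<_; NonZero)
open import Data.Nat.DivMod using (_%_; m%n<n)
open import Data.Fin using (Fin; toℕ; fromℕ<)
open import Data.Fin.Patterns using (0F; 1F; 2F; 3F)
open import Data.Product using (_×_; _,_; ∃-syntax)
open import Data.Sum using (_⊎_)
open import Data.List using (List; length)
open import Data.List.Membership.Propositional using (_∈_)
open import Data.List.Relation.Unary.All using (All)
open import Data.List.Relation.Unary.Unique.Propositional using (Unique)
open import Relation.Binary.PropositionalEquality using (_≡_)
open import Relation.Nullary using (¬_)

-- Vertices of the prism D_n = C_n □ P_2:
-- (0F , i) is v_{i+1} (outer n-cycle), (1F , i) is u_{i+1} (inner n-cycle).
Vertex : ℕ → Set
Vertex n = Fin 2 × Fin n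

idx : ∀ {n} .{{_ : NonZero n}} → ℕ → Fin n
idx {n} j = fromℕ< (m%n<n j n)

data Face (n : ℕ) : Set where
  outer : Face n
  inner : Face n
  quad  : Fin n → Face n

faceLen : ∀ {n} → Face n → ℕ
faceLen {n} outer = n
faceLen {n} inner = n
faceLen (quad _) = 4

quadVertex : ∀ {n} .{{_ : NonZero n}} → Fin n → Fin 4 → Vertex n
quadVertex i 0F = 0F , i
quadVertex i 1F = 0F , idx (suc (toℕ i))
quadVertex i 2F = 1F , idx (suc (toℕ i))
quadVertex i 3F = 1F , i

faceWalk : ∀ {n} .{{_ : NonZero n}} → Face n → ℕ → Vertex n
faceWalk outer j = 0F , idx j
faceWalk inner j = 1F , idx j
faceWalk (quad i) j = quadVertex i (fromℕ< (m%n<n j 4))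

-- A facial path on 2t vertices: consecutive vertices of a face boundary walk,
-- starting at position s, traversed in direction step (1 = forward,
-- faceLen f ∸ 1 ≡ -1 mod faceLen f = backward).  Since every face boundary is a
-- cycle, the 2t vertices form a path iff 2t ≤ faceLen f.
FacialRepetition : ∀ {n} .{{_ : NonZero n}} → (Vertex n → ℕ) → Set
FacialRepetition {n} φ =
  ∃[ f ] ∃[ s ] ∃[ step ] ∃[ t ]
    ((step ≡ 1 ⊎ step ≡ faceLen f ∸ 1)
    × 1 ≤ t
    × t + t ≤ faceLen f
    × (∀ j → j < t →
         φ (faceWalk f (s + step * j)) ≡ φ (faceWalk f (s + step * (j + t)))))

FacialNonRepetitive : ∀ {n} .{{_ : NonZero n}} → (Vertex n → ℕ) → Set
FacialNonRepetitive φ = ¬ FacialRepetition φ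

Admissible : ∀ {n} → ℕ → (Vertex n → List ℕ) → Set
Admissible l L = ∀ v → Unique (L v) × l ≤ length (L v) × All (λ c → 1 ≤ c) (L v)

PiFLAtMost : (n : ℕ) .{{_ : NonZero n}} → ℕ → Set
PiFLAtMost n l =
  (L : Vertex n → List ℕ) → Admissible l L →
  ∃[ φ ] ((∀ v → φ v ∈ L v) × FacialNonRepetitive {n} φ)

module Submission where

-- Every face of D_n is bounded by a cycle, so a facial repetition is a square
-- (a block xx) of length at most the face length read along a cycle.  Using
-- lists of eight colours we colour the outer cycle v₀ … v_m (n = m + 1) with a
-- "marker" colour c at v₀ followed by a square-free word avoiding c, and the
-- inner cycle likewise, with a marker at u₀ and a square-free word on u₁ … u_m
-- that also avoids both outer neighbours φ v_k and φ v_{k−1} of each u_k.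
-- Each list thus loses at most three colours, leaving the five needed for
-- square-free words.

open import Defs
open import Data.Nat using (ℕ; zero; suc; _+_; _*_; _∸_; _≤_; _<_; z≤n; s≤s; s≤s⁻¹; _≤?_; _<?_; _≟_; NonZero)
open import Data.Nat.Properties
open import Data.Nat.DivMod using (_%_; _/_; m%n<n; m≡m%n+[m/n]*n; [m+kn]%n≡m%n; m<n⇒m%n≡m; n%n≡0)
open import Data.Nat.Divisibility using (_∣_; ∣m+n∣m⇒∣n; ∣⇒≤; n∣m*n; m%n≡0⇒n∣m; n∣m⇒m%n≡0)
open import Data.Nat.Tactic.RingSolver using (solve-∀)
open import Algebra.Properties.CommutativeSemigroup +-commutativeSemigroup using (xy∙z≈xz∙y)
open import Data.Fin using (Fin; toℕ; fromℕ<)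
open import Data.Fin.Patterns using (0F; 1F; 2F; 3F)
open import Data.Fin.Properties using (any?; toℕ-fromℕ<; fromℕ<-cong; fromℕ<-toℕ; toℕ<n)
open import Data.Product using (_×_; _,_; ∃; ∃-syntax; Σ; proj₁; proj₂)
open import Data.Sum using (_⊎_; inj₁; inj₂)
open import Data.Empty using (⊥; ⊥-elim)
open import Data.Unit using (⊤; tt)
import Data.List as List
open import Data.List using (List; []; _∷_; [_]; length; take; drop; _++_; map; filter; cartesianProductWith; applyUpTo)
open import Data.List.Properties using (≡-dec; length-drop; take++drop≡id; length-++; length-map; ∷-injective; length-applyUpTo)
open import Data.List.Membership.Propositional using (_∈_; _∉_)
open import Data.List.Membership.DecPropositional _≟_ using (_∈?_)
open import Data.List.Membership.Propositional.Properties using (∈-∃++; ∈-++⁺ˡ; ∈-++⁺ʳ; ∈-map⁺; ∈-filter⁻; ∈-cartesianProductWith⁻)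
open import Data.List.Relation.Unary.Any using (here; there)
open import Data.List.Relation.Unary.All using (All; []; _∷_) renaming (lookup to All-lookup)
open import Data.List.Relation.Unary.All.Properties using (applyUpTo⁺₂)
open import Data.List.Relation.Unary.Unique.Propositional using (Unique)
import Data.List.Relation.Unary.Unique.Propositional.Properties as Unique
import Data.List.Relation.Unary.AllPairs as AllPairs
open import Data.List.Relation.Binary.Pointwise using (Pointwise; []; _∷_)
open import Data.List.Relation.Binary.Pointwise.Properties using (Pointwise-length)
open import Relation.Nullary using (¬_; Dec; yes; no; contradiction)
open import Relation.Nullary.Decidable using (_×-dec_; ¬?)
open import Relation.Binary.PropositionalEquality using (_≡_; refl; sym; trans; cong; cong₂; subst; _≢_; module ≡-Reasoning)

Square : (ℕ → ℕ) → ℕ → Set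
Square u t = ∀ j → j < t → u j ≡ u (j + t)

Square-cong : ∀ {u v : ℕ → ℕ} t → (∀ j → j < t + t → u j ≡ v j) → Square u t → Square v t
Square-cong t u≗v sq j j<t =
  trans (sym (u≗v j (≤-trans j<t (m≤m+n t t))))
        (trans (sq j j<t) (u≗v (j + t) (+-monoˡ-< t j<t)))

SquareFreeUpTo : ℕ → (ℕ → ℕ) → Set
SquareFreeUpTo m a = ∀ k t → 1 ≤ t → k + (t + t) ≤ m → ¬ Square (λ j → a (k + j)) t

SquareFreeUpTo-cong : ∀ {m} {a b : ℕ → ℕ} → (∀ i → i < m → a i ≡ b i) →
  SquareFreeUpTo m a → SquareFreeUpTo m b
SquareFreeUpTo-cong a≗b sf k t t≥1 fits sq =
  sf k t t≥1 fits (Square-cong t (λ j j<2t → sym (a≗b (k + j) (<-≤-trans (+-monoʳ-< k j<2t) fits))) sq)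

PrefixSquare : ℕ → List ℕ → Set
PrefixSquare t y = 1 ≤ t × t + t ≤ length y × take t y ≡ take t (drop t y)

prefixSquare? : ∀ t y → Dec (PrefixSquare t y)
prefixSquare? t y = (1 ≤? t) ×-dec ((t + t ≤? length y) ×-dec ≡-dec _≟_ (take t y) (take t (drop t y)))

HasPrefixSquare : List ℕ → Set
HasPrefixSquare y = Σ (Fin (length y)) λ i → PrefixSquare (suc (toℕ i)) y

hasPrefixSquare? : ∀ y → Dec (HasPrefixSquare y)
hasPrefixSquare? y = any? (λ i → prefixSquare? (suc (toℕ i)) y)

SquareFree : List ℕ → Set
SquareFree []       = ⊤
SquareFree (x ∷ xs) = ¬ HasPrefixSquare (x ∷ xs) × SquareFree xs

squareFree? : ∀ y → Dec (SquareFree y)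
squareFree? []       = yes tt
squareFree? (x ∷ xs) = ¬? (hasPrefixSquare? (x ∷ xs)) ×-dec squareFree? xs

sfWords : List (List ℕ) → List (List ℕ)
sfWords []       = [] ∷ []
sfWords (L ∷ Ls) = filter squareFree? (cartesianProductWith _∷_ L (sfWords Ls))

∈-sfWords⁻ : ∀ L Ls {ys} → ys ∈ sfWords (L ∷ Ls) →
  ∃[ x ] ∃[ cs ] (x ∈ L × cs ∈ sfWords Ls × ys ≡ x ∷ cs × SquareFree ys)
∈-sfWords⁻ L Ls m with ∈-filter⁻ squareFree? {xs = cartesianProductWith _∷_ L (sfWords Ls)} m
... | m′ , sf with ∈-cartesianProductWith⁻ _∷_ L (sfWords Ls) m′
...   | x , cs , x∈ , cs∈ , eq = x , cs , x∈ , cs∈ , eq , sf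

sfWords-sound : ∀ Ls {ys} → ys ∈ sfWords Ls → Pointwise _∈_ ys Ls × SquareFree ys
sfWords-sound []       (here refl) = [] , tt
sfWords-sound (L ∷ Ls) m with ∈-sfWords⁻ L Ls m
... | x , cs , x∈ , cs∈ , refl , sf = (x∈ ∷ proj₁ (sfWords-sound Ls cs∈)) , sf

sfWords-drop : ∀ k Ls {ys} → ys ∈ sfWords Ls → drop k ys ∈ sfWords (drop k Ls)
sfWords-drop zero    Ls       m           = m
sfWords-drop (suc k) []       (here refl) = here refl
sfWords-drop (suc k) (L ∷ Ls) m with ∈-sfWords⁻ L Ls m
... | _ , _ , _ , cs∈ , refl , _ = sfWords-drop k Ls cs∈

sfWords-unique : ∀ Ls → All Unique Ls → Unique (sfWords Ls)
sfWords-unique []       _          = [] AllPairs.∷ AllPairs.[]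
sfWords-unique (L ∷ Ls) (uL ∷ uLs) =
  Unique.filter⁺ squareFree? (Unique.cartesianProductWith⁺ _∷_ ∷-injective uL (sfWords-unique Ls uLs))

doubled : ℕ → List ℕ → List ℕ
doubled t r = take t r ++ r

-- For t = 1 this covers every x ∷ cs with
-- cs ∈ sfWords Ls that starts with a square of half-length k + 1, as such a
-- word equals doubled (k + 1) (drop k cs).
squareCandidates : ℕ → List (List ℕ) → List (List ℕ)
squareCandidates t []       = map (doubled t) (sfWords [])
squareCandidates t (L ∷ Ls) = map (doubled t) (sfWords (L ∷ Ls)) ++ squareCandidates (suc t) Ls

weight : List (List ℕ) → ℕ
weight []       = 1
weight (L ∷ Ls) = length (sfWords (L ∷ Ls)) + weight Ls

length-squareCandidates : ∀ t Ls → length (squareCandidates t Ls) ≡ weight Ls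
length-squareCandidates t []       = refl
length-squareCandidates t (L ∷ Ls) = begin
  length (map (doubled t) (sfWords (L ∷ Ls)) ++ squareCandidates (suc t) Ls)
    ≡⟨ length-++ (map (doubled t) (sfWords (L ∷ Ls))) ⟩
  length (map (doubled t) (sfWords (L ∷ Ls))) + length (squareCandidates (suc t) Ls)
    ≡⟨ cong₂ _+_ (length-map (doubled t) (sfWords (L ∷ Ls))) (length-squareCandidates (suc t) Ls) ⟩
  weight (L ∷ Ls) ∎
  where open ≡-Reasoning

doubled-[] : ∀ t → doubled t [] ≡ []
doubled-[] zero    = refl
doubled-[] (suc t) = refl

∈-squareCandidates : ∀ k t Ls {r} → r ∈ sfWords (drop k Ls) → doubled (k + t) r ∈ squareCandidates t Ls
∈-squareCandidates zero    t []       m           = ∈-map⁺ (doubled t) m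
∈-squareCandidates zero    t (L ∷ Ls) m           = ∈-++⁺ˡ (∈-map⁺ (doubled t) m)
∈-squareCandidates (suc k) t []       (here refl) = here (trans (doubled-[] (suc k + t)) (sym (doubled-[] t)))
∈-squareCandidates (suc k) t (L ∷ Ls) {r} m =
  ∈-++⁺ʳ (map (doubled t) (sfWords (L ∷ Ls)))
    (subst (λ z → doubled z r ∈ squareCandidates (suc t) Ls) (+-suc k t) (∈-squareCandidates k (suc t) Ls m))

unique-⊆-length : ∀ {A : Set} (xs ys : List A) → Unique xs → (∀ {v} → v ∈ xs → v ∈ ys) → length xs ≤ length ys
unique-⊆-length []       ys _              _   = z≤n
unique-⊆-length (x ∷ xs) ys (x∉xs AllPairs.∷ uxs) xs⊆ys with ∈-∃++ (xs⊆ys (here refl))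
... | ys₁ , ys₂ , refl = begin
  suc (length xs)               ≤⟨ s≤s (unique-⊆-length xs (ys₁ ++ ys₂) uxs xs⊆ys₁ys₂) ⟩
  suc (length (ys₁ ++ ys₂))     ≡⟨ cong suc (length-++ ys₁) ⟩
  suc (length ys₁ + length ys₂) ≡⟨ sym (+-suc (length ys₁) (length ys₂)) ⟩
  length ys₁ + length (x ∷ ys₂) ≡⟨ sym (length-++ ys₁) ⟩
  length (ys₁ ++ x ∷ ys₂)       ∎
  where
  open ≤-Reasoning
  remove : ∀ {v} zs₁ → v ∈ zs₁ ++ x ∷ ys₂ → v ≢ x → v ∈ zs₁ ++ ys₂
  remove []        (here v≡x) v≢x = ⊥-elim (v≢x v≡x)
  remove []        (there v∈) _   = v∈
  remove (z ∷ zs₁) (here v≡z) _   = here v≡z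
  remove (z ∷ zs₁) (there v∈) v≢x = there (remove zs₁ v∈ v≢x)
  xs⊆ys₁ys₂ : ∀ {v} → v ∈ xs → v ∈ ys₁ ++ ys₂
  xs⊆ys₁ys₂ v∈xs = remove ys₁ (xs⊆ys (there v∈xs)) (λ v≡x → All-lookup x∉xs v∈xs (sym v≡x))

length-cartesianProductWith : ∀ (xs : List ℕ) (ys : List (List ℕ)) →
  length (cartesianProductWith _∷_ xs ys) ≡ length xs * length ys
length-cartesianProductWith []       ys = refl
length-cartesianProductWith (x ∷ xs) ys =
  trans (length-++ (map (List._∷_ x) ys))
        (cong₂ _+_ (length-map (List._∷_ x) ys) (length-cartesianProductWith xs ys))

length-filter-split : ∀ {A : Set} {P : A → Set} (P? : ∀ x → Dec (P x)) (xs : List A) →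
  length xs ≡ length (filter P? xs) + length (filter (λ x → ¬? (P? x)) xs)
length-filter-split P? []       = refl
length-filter-split P? (x ∷ xs) with P? x
... | yes _ = cong suc (length-filter-split P? xs)
... | no  _ = trans (cong suc (length-filter-split P? xs)) (sym (+-suc _ _))

-- Extending a square-free word cs by a letter x either keeps it square-free or
-- creates a square prefix of some half-length k + 1, in which case
-- x ∷ cs = doubled (k + 1) (drop k cs) is one of the square candidates.
nonSquareFree⊆candidates : ∀ L Ls {y} →
  y ∈ filter (λ z → ¬? (squareFree? z)) (cartesianProductWith _∷_ L (sfWords Ls)) →
  y ∈ squareCandidates 1 Ls
nonSquareFree⊆candidates L Ls m with ∈-filter⁻ (λ z → ¬? (squareFree? z)) {xs = cartesianProductWith _∷_ L (sfWords Ls)} m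
... | m′ , ¬sf with ∈-cartesianProductWith⁻ _∷_ L (sfWords Ls) m′
...   | x , cs , _ , cs∈ , refl with hasPrefixSquare? (x ∷ cs)
...     | no ¬sq = ⊥-elim (¬sf (¬sq , proj₂ (sfWords-sound Ls cs∈)))
...     | yes (i , _ , _ , halves) = subst (_∈ squareCandidates 1 Ls) y≡ candidate
  where
  k : ℕ
  k = toℕ i
  candidate : doubled (k + 1) (drop k cs) ∈ squareCandidates 1 Ls
  candidate = ∈-squareCandidates k 1 Ls (sfWords-drop k Ls cs∈)
  y≡ : doubled (k + 1) (drop k cs) ≡ x ∷ cs
  y≡ = begin
    take (k + 1) (drop k cs) ++ drop k cs   ≡⟨ cong (λ z → take z (drop k cs) ++ drop k cs) (+-comm k 1) ⟩
    take (suc k) (drop k cs) ++ drop k cs   ≡⟨ cong (_++ drop k cs) (sym halves) ⟩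
    take (suc k) (x ∷ cs) ++ drop k cs      ≡⟨ take++drop≡id (suc k) (x ∷ cs) ⟩
    x ∷ cs                                  ∎
    where open ≡-Reasoning

growth : ∀ {a b g} → 5 * g ≤ a + b → b ≤ g + g → g + g + g ≤ a
growth {a} {b} {g} 5g≤a+b b≤2g = +-cancelʳ-≤ (g + g) (g + g + g) a (begin
  (g + g + g) + (g + g) ≡⟨ split5 g ⟩
  5 * g                 ≤⟨ 5g≤a+b ⟩
  a + b                 ≤⟨ +-monoʳ-≤ a b≤2g ⟩
  a + (g + g)           ∎)
  where
  open ≤-Reasoning
  split5 : ∀ g → (g + g + g) + (g + g) ≡ 5 * g
  split5 = solve-∀

-- Counting invariant (Rosenfeld): with lists of size ≥ 5 there is a
-- square-free word, and the number of square candidates is at most twice the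
-- number of square-free words.  Each of the 5g extensions of the g square-free
-- words over Ls is either square-free or a candidate, so at least 3g extensions
-- survive, which re-establishes both claims.
counting : ∀ Ls → All (λ L → 5 ≤ length L) Ls → All Unique Ls →
  1 ≤ length (sfWords Ls) × weight Ls ≤ length (sfWords Ls) + length (sfWords Ls)
counting []       _          _          = s≤s z≤n , s≤s z≤n
counting (L ∷ Ls) (5≤L ∷ 5≤Ls) (uL ∷ uLs) = 1≤a , weight≤
  where
  extensions : List (List ℕ)
  extensions = cartesianProductWith _∷_ L (sfWords Ls)
  g a b : ℕ
  g = length (sfWords Ls)
  a = length (sfWords (L ∷ Ls))
  b = length (filter (λ y → ¬? (squareFree? y)) extensions)
  ih : 1 ≤ g × weight Ls ≤ g + g
  ih = counting Ls 5≤Ls uLs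
  b≤2g : b ≤ g + g
  b≤2g = begin
    b                                     ≤⟨ unique-⊆-length _ (squareCandidates 1 Ls)
                                               (Unique.filter⁺ (λ y → ¬? (squareFree? y))
                                                 (Unique.cartesianProductWith⁺ _∷_ ∷-injective uL (sfWords-unique Ls uLs)))
                                               (nonSquareFree⊆candidates L Ls) ⟩
    length (squareCandidates 1 Ls)        ≡⟨ length-squareCandidates 1 Ls ⟩
    weight Ls                             ≤⟨ proj₂ ih ⟩
    g + g                                 ∎
    where open ≤-Reasoning
  5g≤a+b : 5 * g ≤ a + b
  5g≤a+b = begin
    5 * g                ≤⟨ *-monoˡ-≤ g 5≤L ⟩
    length L * g         ≡⟨ sym (length-cartesianProductWith L (sfWords Ls)) ⟩
    length extensions    ≡⟨ length-filter-split squareFree? extensions ⟩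
    a + b                ∎
    where open ≤-Reasoning
  3g≤a : g + g + g ≤ a
  3g≤a = growth {a} {b} {g} 5g≤a+b b≤2g
  1≤a : 1 ≤ a
  1≤a = ≤-trans (proj₁ ih) (≤-trans (≤-trans (m≤m+n g g) (m≤m+n (g + g) g)) 3g≤a)
  weight≤ : a + weight Ls ≤ a + a
  weight≤ = +-monoʳ-≤ a (≤-trans (proj₂ ih) (≤-trans (m≤m+n (g + g) g) 3g≤a))

squareFreeWord : ∀ Ls → All (λ L → 5 ≤ length L) Ls → All Unique Ls →
  ∃[ cs ] (Pointwise _∈_ cs Ls × SquareFree cs)
squareFreeWord Ls 5≤Ls uLs with sfWords Ls in eq | proj₁ (counting Ls 5≤Ls uLs)
... | cs ∷ _ | _ = cs , sfWords-sound Ls (subst (cs ∈_) (sym eq) (here refl))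

-- Reading a list as a sequence (with default 0 past its end).
at : List ℕ → ℕ → ℕ
at []       _       = 0
at (x ∷ xs) zero    = x
at (x ∷ xs) (suc i) = at xs i

at-drop : ∀ k cs i → at (drop k cs) i ≡ at cs (k + i)
at-drop zero    cs       i = refl
at-drop (suc k) []       i = refl
at-drop (suc k) (x ∷ cs) i = at-drop k cs i

take-cong : ∀ t y z → t ≤ length y → t ≤ length z → (∀ j → j < t → at y j ≡ at z j) → take t y ≡ take t z
take-cong zero    y       z       _       _       _    = refl
take-cong (suc t) (x ∷ y) (w ∷ z) (s≤s ty) (s≤s tz) y≗z =
  cong₂ List._∷_ (y≗z 0 (s≤s z≤n)) (take-cong t y z ty tz (λ j j<t → y≗z (suc j) (s≤s j<t)))

squareFree-drop : ∀ k cs → SquareFree cs → SquareFree (drop k cs)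
squareFree-drop zero    cs       sf = sf
squareFree-drop (suc k) []       sf = tt
squareFree-drop (suc k) (x ∷ cs) sf = squareFree-drop k cs (proj₂ sf)

squareFree⇒¬PrefixSquare : ∀ y t → SquareFree y → ¬ PrefixSquare t y
squareFree⇒¬PrefixSquare []      (suc t) _        (_ , () , _)
squareFree⇒¬PrefixSquare (x ∷ y) (suc t) (¬sq , _) sq@(_ , fits , _) =
  ¬sq (fromℕ< t<len , subst (λ z → PrefixSquare z (x ∷ y)) (sym (cong suc (toℕ-fromℕ< t<len))) sq)
  where
  t<len : t < length (x ∷ y)
  t<len = ≤-trans (s≤s (m≤m+n t (suc t))) fits

-- A square factor at offset k of a square-free list is a square prefix of its
-- k-th suffix, which is impossible.
squareFree⇒SquareFreeUpTo : ∀ cs → SquareFree cs → SquareFreeUpTo (length cs) (at cs)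
squareFree⇒SquareFreeUpTo cs sf k t t≥1 fits sq =
  squareFree⇒¬PrefixSquare y t (squareFree-drop k cs sf) (t≥1 , 2t≤y , halves)
  where
  y : List ℕ
  y = drop k cs
  2t≤y : t + t ≤ length y
  2t≤y = subst (t + t ≤_) (sym (length-drop k cs))
           (subst (_≤ length cs ∸ k) (m+n∸m≡n k (t + t)) (∸-monoˡ-≤ k fits))
  t≤rest : t ≤ length (drop t y)
  t≤rest = subst (t ≤_) (sym (length-drop t y))
             (subst (_≤ length y ∸ t) (m+n∸m≡n t t) (∸-monoˡ-≤ t 2t≤y))
  halves : take t y ≡ take t (drop t y)
  halves = take-cong t y (drop t y) (≤-trans (m≤m+n t t) 2t≤y) t≤rest λ j j<t → begin
    at y j                 ≡⟨ at-drop k cs j ⟩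
    at cs (k + j)          ≡⟨ sq j j<t ⟩
    at cs (k + (j + t))    ≡⟨ cong (λ z → at cs (k + z)) (+-comm j t) ⟩
    at cs (k + (t + j))    ≡⟨ sym (at-drop k cs (t + j)) ⟩
    at y (t + j)           ≡⟨ sym (at-drop t y j) ⟩
    at (drop t y) j        ∎
    where open ≡-Reasoning

at-applyUpTo : ∀ (L : ℕ → List ℕ) m cs → Pointwise _∈_ cs (applyUpTo L m) → ∀ i → i < m → at cs i ∈ L i
at-applyUpTo L (suc m) (c ∷ cs) (c∈ ∷ cs∈) zero    _         = c∈
at-applyUpTo L (suc m) (c ∷ cs) (c∈ ∷ cs∈) (suc i) (s≤s i<m) = at-applyUpTo (λ k → L (suc k)) m cs cs∈ i i<m

squareFreeChoice : ∀ m (L : ℕ → List ℕ) → (∀ k → Unique (L k)) → (∀ k → 5 ≤ length (L k)) →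
  ∃[ a ] ((∀ k → k < m → a k ∈ L k) × SquareFreeUpTo m a)
squareFreeChoice m L uL 5≤L with squareFreeWord (applyUpTo L m) (applyUpTo⁺₂ L m 5≤L) (applyUpTo⁺₂ L m uL)
... | cs , cs∈ , sf = at cs , at-applyUpTo L m cs cs∈ , subst (λ z → SquareFreeUpTo z (at cs)) len sf′
  where
  len : length cs ≡ m
  len = trans (Pointwise-length cs∈) (length-applyUpTo L m)
  sf′ : SquareFreeUpTo (length cs) (at cs)
  sf′ = squareFree⇒SquareFreeUpTo cs sf

-- The colours met when walking round a p-cycle whose vertices are coloured by
-- g; every face boundary walk of Defs is of this form.
cyclic : ∀ {p} .{{_ : NonZero p}} → (Fin p → ℕ) → ℕ → ℕ
cyclic g j = g (idx j)

Periodic : ℕ → (ℕ → ℕ) → Set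
Periodic p w = ∀ j k → w (j + k * p) ≡ w j

cyclic-periodic : ∀ {p} .{{_ : NonZero p}} (g : Fin p → ℕ) → Periodic p (cyclic g)
cyclic-periodic {p} g j k = cong g (fromℕ<-cong _ _ ([m+kn]%n≡m%n j k p) _ _)

NoForwardSquare : ℕ → (ℕ → ℕ) → Set
NoForwardSquare p w = ∀ s t → 1 ≤ t → t + t ≤ p → ¬ Square (λ j → w (s + j)) t

-- Index bookkeeping for reading a cycle backwards (u = j + d).
reverse-index₁ : ∀ s m j d → s + m * (suc (j + d) + (j + d)) + j ≡ s + m * (d + suc (j + d)) + j * suc m
reverse-index₁ = solve-∀

reverse-index₂ : ∀ s m j d →
  s + m * (suc (j + d) + (j + d)) + (j + suc (j + d)) ≡ s + m * d + (j + suc (j + d)) * suc m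
reverse-index₂ = solve-∀

-- Reading a square backwards gives a square: for a (m+1)-periodic w, stepping
-- by m is stepping by −1, and the 2t terms w(s), w(s−1), …, w(s−2t+1) are
-- the terms w(s′), …, w(s′+2t−1) in reverse, with s′ = s + m(2t−1).
backward⇒forward : ∀ m w → Periodic (suc m) w → ∀ s u →
  Square (λ j → w (s + m * j)) (suc u) → Square (λ j → w (s + m * (suc u + u) + j)) (suc u)
backward⇒forward m w per s u sq j j≤u = begin
  w (s + m * (suc u + u) + j)           ≡⟨ cong w (shift₁ u d u≡j+d) ⟩
  w (s + m * (d + suc u) + j * suc m)   ≡⟨ per _ j ⟩
  w (s + m * (d + suc u))               ≡⟨ sym (sq d d<t) ⟩
  w (s + m * d)                         ≡⟨ sym (per _ (j + suc u)) ⟩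
  w (s + m * d + (j + suc u) * suc m)   ≡⟨ cong w (sym (shift₂ u d u≡j+d)) ⟩
  w (s + m * (suc u + u) + (j + suc u)) ∎
  where
  open ≡-Reasoning
  d : ℕ
  d = u ∸ j
  u≡j+d : u ≡ j + d
  u≡j+d = sym (m+[n∸m]≡n (s≤s⁻¹ j≤u))
  d<t : d < suc u
  d<t = s≤s (m∸n≤m u j)
  shift₁ : ∀ u d → u ≡ j + d → s + m * (suc u + u) + j ≡ s + m * (d + suc u) + j * suc m
  shift₁ _ d refl = reverse-index₁ s m j d
  shift₂ : ∀ u d → u ≡ j + d → s + m * (suc u + u) + (j + suc u) ≡ s + m * d + (j + suc u) * suc m
  shift₂ _ d refl = reverse-index₂ s m j d

-- Hence on a cycle it suffices to exclude forward squares: a facial path may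
-- be traversed with step 1 or step m ≡ −1.
cycleNoSquare : ∀ m (g : Fin (suc m) → ℕ) → NoForwardSquare (suc m) (cyclic g) →
  ∀ s step t → step ≡ 1 ⊎ step ≡ m → 1 ≤ t → t + t ≤ suc m → ¬ Square (λ j → cyclic g (s + step * j)) t
cycleNoSquare m g noSq s .1 t (inj₁ refl) t≥1 short sq =
  noSq s t t≥1 short (Square-cong t (λ j _ → cong (λ z → cyclic g (s + z)) (*-identityˡ j)) sq)
cycleNoSquare m g noSq s .m (suc u) (inj₂ refl) t≥1 short sq =
  noSq (s + m * (suc u + u)) (suc u) t≥1 short (backward⇒forward m (cyclic g) (cyclic-periodic g) s u sq)

adjacent-distinct : ∀ {p} w → 2 ≤ p → NoForwardSquare p w → ∀ k → w k ≢ w (suc k)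
adjacent-distinct w 2≤p noSq k wk≡wk+1 = noSq k 1 (s≤s z≤n) 2≤p square
  where
  square : Square (λ j → w (k + j)) 1
  square zero _ = trans (cong w (+-identityʳ k)) (trans wk≡wk+1 (cong w (+-comm 1 k)))
  square (suc j) (s≤s ())

two-multiples : ∀ {n x t} → n ∣ x → n ∣ x + t → 1 ≤ t → t + t ≤ n → ⊥
two-multiples {n} {x} {suc u} n∣x n∣x+t _ short =
  <⇒≱ (<-≤-trans (m<m+n (suc u) (s≤s z≤n)) short) (∣⇒≤ (∣m+n∣m⇒∣n n∣x+t n∣x))

-- A window of length 2t ≤ n either contains a marker, whose
-- partner t positions away would be a second marker too close to it, or lies
-- inside a single block; so w has no square of length at most n.
markedCycle : ∀ m w c → (∀ k → w k ≡ c → suc m ∣ k) → (∀ k → suc m ∣ k → w k ≡ c) →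
  (∀ q → SquareFreeUpTo m (λ i → w (suc i + q * suc m))) → NoForwardSquare (suc m) w
markedCycle m w c marker⇒∣ ∣⇒marker blocks s t t≥1 short sq =
  window (s % n) (s / n) (m≡m%n+[m/n]*n s n) (m%n<n s n)
  where
  n : ℕ
  n = suc m
  noMarker : ∀ j → j < t + t → n ∣ s + j → ⊥
  noMarker j j<2t n∣s+j with j <? t
  ... | yes j<t = two-multiples n∣s+j n∣s+j+t t≥1 short
    where
    n∣s+j+t : n ∣ s + j + t
    n∣s+j+t = subst (n ∣_) (sym (+-assoc s j t))
                (marker⇒∣ _ (trans (sym (sq j j<t)) (∣⇒marker _ n∣s+j)))
  ... | no j≮t = two-multiples n∣s+i (subst (n ∣_) s+j≡s+i+t n∣s+j) t≥1 short
    where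
    i : ℕ
    i = j ∸ t
    j≡i+t : j ≡ i + t
    j≡i+t = sym (m∸n+n≡m (≮⇒≥ j≮t))
    i<t : i < t
    i<t = +-cancelʳ-< t i t (subst (_< t + t) j≡i+t j<2t)
    s+j≡s+i+t : s + j ≡ s + i + t
    s+j≡s+i+t = trans (cong (s +_) j≡i+t) (sym (+-assoc s i t))
    n∣s+i : n ∣ s + i
    n∣s+i = marker⇒∣ _ (trans (sq i i<t) (trans (cong (λ z → w (s + z)) (sym j≡i+t)) (∣⇒marker _ n∣s+j)))
  window : ∀ r q → s ≡ r + q * n → r < n → ⊥
  window zero    q refl _   = noMarker 0 (≤-trans t≥1 (m≤m+n t t)) (subst (n ∣_) (sym (+-identityʳ (q * n))) (n∣m*n q))
  window (suc r) q s≡ r<n with suc r + (t + t) ≤? n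
  ... | yes fits = blocks q r t t≥1 (s≤s⁻¹ fits)
                     (Square-cong t (λ j _ → cong w (shift j)) sq)
    where
    shift : ∀ j → s + j ≡ suc (r + j) + q * n
    shift j = trans (cong (_+ j) s≡) (xy∙z≈xz∙y (suc r) (q * n) j)
  ... | no overflow = noMarker j j<2t (subst (n ∣_) (sym s+j≡) (n∣m*n (suc q)))
    where
    j : ℕ
    j = n ∸ suc r
    j<2t : j < t + t
    j<2t = +-cancelˡ-< (suc r) j (t + t)
             (subst (_< suc r + (t + t)) (sym (m+[n∸m]≡n (<⇒≤ r<n))) (≰⇒> overflow))
    s+j≡ : s + j ≡ suc q * n
    s+j≡ = begin
      s + j                 ≡⟨ cong (_+ j) s≡ ⟩
      suc r + q * n + j     ≡⟨ xy∙z≈xz∙y (suc r) (q * n) j ⟩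
      (suc r + j) + q * n   ≡⟨ cong (_+ q * n) (m+[n∸m]≡n (<⇒≤ r<n)) ⟩
      n + q * n             ∎
      where open ≡-Reasoning

_◃_ : ℕ → (ℕ → ℕ) → ℕ → ℕ
(c ◃ a) zero    = c
(c ◃ a) (suc i) = a i

markedCycle-◃ : ∀ m c a → (∀ i → i < m → a i ≢ c) → SquareFreeUpTo m a →
  NoForwardSquare (suc m) (cyclic {suc m} (λ i → (c ◃ a) (toℕ i)))
markedCycle-◃ m c a a≢c sf = markedCycle m w c marker⇒∣ ∣⇒marker blocks
  where
  n : ℕ
  n = suc m
  w : ℕ → ℕ
  w = cyclic {n} (λ i → (c ◃ a) (toℕ i))
  w≡ : ∀ k → w k ≡ (c ◃ a) (k % n)
  w≡ k = cong (c ◃ a) (toℕ-fromℕ< (m%n<n k n))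
  onlyAtZero : ∀ r → r < n → (c ◃ a) r ≡ c → r ≡ 0
  onlyAtZero zero    _         _   = refl
  onlyAtZero (suc i) (s≤s i<m) a≡c = contradiction a≡c (a≢c i i<m)
  marker⇒∣ : ∀ k → w k ≡ c → n ∣ k
  marker⇒∣ k wk≡c = m%n≡0⇒n∣m k n (onlyAtZero (k % n) (m%n<n k n) (trans (sym (w≡ k)) wk≡c))
  ∣⇒marker : ∀ k → n ∣ k → w k ≡ c
  ∣⇒marker k n∣k = trans (w≡ k) (cong (c ◃ a) (n∣m⇒m%n≡0 k n n∣k))
  blocks : ∀ q → SquareFreeUpTo m (λ i → w (suc i + q * n))
  blocks q = SquareFreeUpTo-cong block sf
    where
    block : ∀ i → i < m → a i ≡ w (suc i + q * n)
    block i i<m = sym (trans (w≡ (suc i + q * n))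
      (cong (c ◃ a) (trans ([m+kn]%n≡m%n (suc i) q n) (m<n⇒m%n≡m (s≤s i<m)))))

square-mod : ∀ p .{{_ : NonZero p}} w → Periodic p w → ∀ s t →
  Square (λ j → w (s + j)) t → Square (λ j → w (s % p + j)) t
square-mod p w per s t = Square-cong t λ j _ → begin
  w (s + j)                      ≡⟨ cong (λ z → w (z + j)) (m≡m%n+[m/n]*n s p) ⟩
  w (s % p + s / p * p + j)      ≡⟨ cong w (xy∙z≈xz∙y (s % p) (s / p * p) j) ⟩
  w (s % p + j + (s / p) * p)    ≡⟨ per (s % p + j) (s / p) ⟩
  w (s % p + j)                  ∎
  where open ≡-Reasoning

-- A quadrangle whose four edges and one diagonal join distinct colours has no
-- square: half-length 1 needs an edge, half-length 2 the pattern xyxy.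
quadrangle : (g : Fin 4 → ℕ) → g 0F ≢ g 1F → g 1F ≢ g 2F → g 2F ≢ g 3F → g 3F ≢ g 0F → g 0F ≢ g 2F →
  NoForwardSquare 4 (cyclic g)
quadrangle g g01 g12 g23 g30 g02 s t t≥1 short sq =
  fromStart (s % 4) (m%n<n s 4) t t≥1 short (square-mod 4 (cyclic g) (cyclic-periodic g) s t sq)
  where
  fromStart : ∀ r → r < 4 → ∀ t → 1 ≤ t → t + t ≤ 4 → ¬ Square (λ j → cyclic g (r + j)) t
  fromStart 0 _ 1 _ _ sq = g01 (sq 0 (s≤s z≤n))
  fromStart 1 _ 1 _ _ sq = g12 (sq 0 (s≤s z≤n))
  fromStart 2 _ 1 _ _ sq = g23 (sq 0 (s≤s z≤n))
  fromStart 3 _ 1 _ _ sq = g30 (sq 0 (s≤s z≤n))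
  fromStart 0 _ 2 _ _ sq = g02 (sq 0 (s≤s z≤n))
  fromStart 1 _ 2 _ _ sq = g02 (sym (sq 1 (s≤s (s≤s z≤n))))
  fromStart 2 _ 2 _ _ sq = g02 (sym (sq 0 (s≤s z≤n)))
  fromStart 3 _ 2 _ _ sq = g02 (sq 1 (s≤s (s≤s z≤n)))
  fromStart (suc (suc (suc (suc _)))) (s≤s (s≤s (s≤s (s≤s ())))) _ _ _ _
  fromStart r _ (suc (suc (suc k))) _ (s≤s (s≤s (s≤s short))) _ with m+n≤o⇒n≤o k short
  ... | s≤s ()

idx-toℕ : ∀ {n} .{{_ : NonZero n}} (i : Fin n) → idx {n} (toℕ i) ≡ i
idx-toℕ {n} i = trans (fromℕ<-cong _ _ (m<n⇒m%n≡m (toℕ<n i)) _ (toℕ<n i)) (fromℕ<-toℕ i (toℕ<n i))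

cyclic-toℕ : ∀ {p} .{{_ : NonZero p}} (g : Fin p → ℕ) (i : Fin p) → cyclic g (toℕ i) ≡ g i
cyclic-toℕ g i = cong g (idx-toℕ i)

avoid : List ℕ → List ℕ → List ℕ
avoid F = filter (λ x → ¬? (x ∈? F))

avoid-sound : ∀ {x} F l → x ∈ avoid F l → x ∈ l × x ∉ F
avoid-sound F l = ∈-filter⁻ (λ x → ¬? (x ∈? F)) {xs = l}

avoid-unique : ∀ F l → Unique l → Unique (avoid F l)
avoid-unique F l = Unique.filter⁺ (λ x → ¬? (x ∈? F))

avoid-length : ∀ F l → Unique l → 8 ≤ length l → length F ≤ 3 → 5 ≤ length (avoid F l)
avoid-length F l ul 8≤l F≤3 = +-cancelˡ-≤ 3 5 (length (avoid F l)) (begin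
  8                                             ≤⟨ 8≤l ⟩
  length l                                      ≡⟨ length-filter-split (_∈? F) l ⟩
  length (filter (_∈? F) l) + length (avoid F l) ≤⟨ +-monoˡ-≤ _ removed≤3 ⟩
  3 + length (avoid F l)                        ∎)
  where
  open ≤-Reasoning
  removed≤3 : length (filter (_∈? F) l) ≤ 3
  removed≤3 = ≤-trans (unique-⊆-length _ F (Unique.filter⁺ (_∈? F) ul)
                         (λ x∈ → proj₂ (∈-filter⁻ (_∈? F) {xs = l} x∈))) F≤3

first : (l : List ℕ) → 1 ≤ length l → ∃ (_∈ l)
first (x ∷ _) _ = x , here refl

-- The outer
-- cycle gets a marker c at v₀ and a square-free word avoiding c on v₁ … v_m;
-- the inner cycle gets a marker c′ ∉ {φ v₀, φ v_m} at u₀ and a square-free word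
-- on u₁ … u_m avoiding c′ and both outer neighbours φ v_k, φ v_{k−1}.
module PrismColouring (m : ℕ) (2≤n : 2 ≤ suc m) (L : Vertex (suc m) → List ℕ) (adm : Admissible 8 L) where

  n : ℕ
  n = suc m

  Lv Lu : ℕ → List ℕ
  Lv k = L (0F , idx {n} k)
  Lu k = L (1F , idx {n} k)

  unique : ∀ v → Unique (L v)
  unique v = proj₁ (adm v)

  8≤L : ∀ v → 8 ≤ length (L v)
  8≤L v = proj₁ (proj₂ (adm v))

  cChoice : ∃ (_∈ Lv 0)
  cChoice = first (Lv 0) (≤-trans (s≤s z≤n) (8≤L _))

  c : ℕ
  c = proj₁ cChoice

  outerAvoid : ℕ → List ℕ
  outerAvoid k = avoid [ c ] (Lv (suc k))

  outerPath : ∃[ a ] ((∀ k → k < m → a k ∈ outerAvoid k) × SquareFreeUpTo m a)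
  outerPath = squareFreeChoice m outerAvoid
                (λ k → avoid-unique [ c ] (Lv (suc k)) (unique _))
                (λ k → avoid-length [ c ] (Lv (suc k)) (unique _) (8≤L _) (s≤s z≤n))

  a : ℕ → ℕ
  a = proj₁ outerPath

  A : ℕ → ℕ
  A = c ◃ a

  c′Choice : ∃ (_∈ avoid (A 0 ∷ A m ∷ []) (Lu 0))
  c′Choice = first _ (≤-trans (s≤s z≤n) (avoid-length (A 0 ∷ A m ∷ []) (Lu 0) (unique _) (8≤L _) (s≤s (s≤s z≤n))))

  c′ : ℕ
  c′ = proj₁ c′Choice

  innerForbidden : ℕ → List ℕ
  innerForbidden k = c′ ∷ A (suc k) ∷ A k ∷ []

  innerAvoid : ℕ → List ℕ
  innerAvoid k = avoid (innerForbidden k) (Lu (suc k))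

  innerPath : ∃[ b ] ((∀ k → k < m → b k ∈ innerAvoid k) × SquareFreeUpTo m b)
  innerPath = squareFreeChoice m innerAvoid
                (λ k → avoid-unique (innerForbidden k) (Lu (suc k)) (unique _))
                (λ k → avoid-length (innerForbidden k) (Lu (suc k)) (unique _) (8≤L _) ≤-refl)

  b : ℕ → ℕ
  b = proj₁ innerPath

  B : ℕ → ℕ
  B = c′ ◃ b

  φ : Vertex n → ℕ
  φ (0F , i) = A (toℕ i)
  φ (1F , i) = B (toℕ i)

  a∈ : ∀ k → k < m → a k ∈ outerAvoid k
  a∈ = proj₁ (proj₂ outerPath)

  b∈ : ∀ k → k < m → b k ∈ innerAvoid k
  b∈ = proj₁ (proj₂ innerPath)

  A∈ : ∀ k → k < n → A k ∈ Lv k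
  A∈ zero    _         = proj₂ cChoice
  A∈ (suc k) (s≤s k<m) = proj₁ (avoid-sound [ c ] (Lv (suc k)) (a∈ k k<m))

  B∈ : ∀ k → k < n → B k ∈ Lu k
  B∈ zero    _         = proj₁ (avoid-sound (A 0 ∷ A m ∷ []) (Lu 0) (proj₂ c′Choice))
  B∈ (suc k) (s≤s k<m) = proj₁ (avoid-sound (innerForbidden k) (Lu (suc k)) (b∈ k k<m))

  φ∈L : ∀ v → φ v ∈ L v
  φ∈L (0F , i) = subst (λ j → A (toℕ i) ∈ L (0F , j)) (idx-toℕ i) (A∈ (toℕ i) (toℕ<n i))
  φ∈L (1F , i) = subst (λ j → B (toℕ i) ∈ L (1F , j)) (idx-toℕ i) (B∈ (toℕ i) (toℕ<n i))

  a≢c : ∀ i → i < m → a i ≢ c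
  a≢c i i<m a≡c = proj₂ (avoid-sound [ c ] (Lv (suc i)) (a∈ i i<m)) (here a≡c)

  b≢c′ : ∀ i → i < m → b i ≢ c′
  b≢c′ i i<m b≡c′ = proj₂ (avoid-sound (innerForbidden i) (Lu (suc i)) (b∈ i i<m)) (here b≡c′)

  rung : ∀ k → k < n → A k ≢ B k
  rung zero    _         A≡B = proj₂ (avoid-sound (A 0 ∷ A m ∷ []) (Lu 0) (proj₂ c′Choice)) (here (sym A≡B))
  rung (suc k) (s≤s k<m) A≡B = proj₂ (avoid-sound (innerForbidden k) (Lu (suc k)) (b∈ k k<m)) (there (here (sym A≡B)))

  diagonal : ∀ k → k < n → A k ≢ B (suc k % n)
  diagonal k k<n = byCases (suc k <? n)
    where
    byCases : Dec (suc k < n) → A k ≢ B (suc k % n)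
    byCases (yes k+1<n) A≡B = proj₂ (avoid-sound (innerForbidden k) (Lu (suc k)) (b∈ k (≤-pred k+1<n)))
      (there (there (here (sym (trans A≡B (cong B (m<n⇒m%n≡m k+1<n)))))))
    byCases (no k+1≮n) A≡B = proj₂ (avoid-sound (A 0 ∷ A m ∷ []) (Lu 0) (proj₂ c′Choice))
      (there (here (sym (trans (cong A (sym k≡m)) (trans A≡B (cong B wraps))))))
      where
      k≡m : k ≡ m
      k≡m = ≤-antisym (≤-pred k<n) (≤-pred (≮⇒≥ k+1≮n))
      wraps : suc k % n ≡ 0
      wraps = trans (cong (λ z → suc z % n) k≡m) (n%n≡0 n)

  outerNoSquare : NoForwardSquare n (cyclic (λ i → φ (0F , i)))
  outerNoSquare = markedCycle-◃ m c a a≢c (proj₂ (proj₂ outerPath))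

  innerNoSquare : NoForwardSquare n (cyclic (λ i → φ (1F , i)))
  innerNoSquare = markedCycle-◃ m c′ b b≢c′ (proj₂ (proj₂ innerPath))

  -- The quadrangle v_k v_{k+1} u_{k+1} u_k: its cycle edges are cycle edges of
  -- D_n or rungs, and the diagonal v_k u_{k+1} is properly coloured.
  quadNoSquare : ∀ i → NoForwardSquare 4 (cyclic (λ p → φ (quadVertex i p)))
  quadNoSquare i = quadrangle (λ p → φ (quadVertex i p)) g01 g12 g23 g30 g02
    where
    k k′ : ℕ
    k  = toℕ i
    k′ = toℕ (idx {n} (suc k))
    k′≡ : k′ ≡ suc k % n
    k′≡ = toℕ-fromℕ< (m%n<n (suc k) n)
    g01 : A k ≢ A k′
    g01 e = adjacent-distinct (cyclic (λ j → φ (0F , j))) 2≤n outerNoSquare k (trans (cyclic-toℕ (λ j → φ (0F , j)) i) e)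
    g12 : A k′ ≢ B k′
    g12 = rung k′ (toℕ<n _)
    g23 : B k′ ≢ B k
    g23 e = adjacent-distinct (cyclic (λ j → φ (1F , j))) 2≤n innerNoSquare k (trans (cyclic-toℕ (λ j → φ (1F , j)) i) (sym e))
    g30 : B k ≢ A k
    g30 e = rung k (toℕ<n i) (sym e)
    g02 : A k ≢ B k′
    g02 e = diagonal k (toℕ<n i) (trans e (cong B k′≡))

  nonRepetitive : FacialNonRepetitive φ
  nonRepetitive (outer  , s , step , t , dir , t≥1 , short , sq) =
    cycleNoSquare m (λ i → φ (0F , i)) outerNoSquare s step t dir t≥1 short sq
  nonRepetitive (inner  , s , step , t , dir , t≥1 , short , sq) =
    cycleNoSquare m (λ i → φ (1F , i)) innerNoSquare s step t dir t≥1 short sq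
  nonRepetitive (quad i , s , step , t , dir , t≥1 , short , sq) =
    cycleNoSquare 3 (λ p → φ (quadVertex i p)) (quadNoSquare i) s step t dir t≥1 short sq

theorem11 : (n : ℕ) .{{_ : NonZero n}} → 3 ≤ n → PiFLAtMost n 8
theorem11 (suc m) 3≤n L adm = φ , φ∈L , nonRepetitive
  where open PrismColouring m (≤-trans (s≤s (s≤s z≤n)) 3≤n) L adm
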